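{- Let $L\ge 1$ and let $c_1,\dots,c_L$ be non-negative integers with $c_1\ge1$ and $c_L\ge1$, and let $\{G_n\}$ be a positive linear recurrence sequence with $G_{n+1}=c_1G_n+\cdots+c_LG_{n+1-L}$. For $n\ge1$ let $H_n$ be the number of super-legal decompositions using only $G_1,\dots,G_n$, i.e. the number of super-legal tuples $(a_1,\dots,a_n)$. Then $H_{n+1}=c_1H_n+c_2H_{n-1}+\cdots+c_LH_{n+1-L}$.
   Context: A tuple $(a_1,\dots,a_n)$ of non-negative integers (representing $\sum_{i=1}^n a_iG_{n+1-i}$) is super-legal if there exists $s\in\{1,\dots,L\}$ such that $a_1=c_1,\dots,a_{s-1}=c_{s-1}$, $a_s<c_s$, $a_{s+1}=\cdots=a_{s+\ell}=0$ for some $\ell\ge0$, and the tuple $(a_{s+\ell+1},\dots,a_n)$ is either super-legal or empty. -}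

module Defs where

open import Data.Nat using (ℕ; zero; suc; _<_; _≤_; _∸_; _*_)
open import Data.Fin using (Fin; toℕ)
open import Data.Vec using (Vec; lookup; toList; tabulate; sum)
open import Data.List using (List; []; _∷_; _++_; take; replicate; length)
open import Data.List.Membership.Propositional using (_∈_)
open import Data.List.Relation.Unary.Unique.Propositional using (Unique)
open import Data.Sum using (_⊎_)
open import Data.Product using (_×_)
open import Relation.Binary.PropositionalEquality using (_≡_)
open import Function.Bundles using (_⇔_)

-- Coefficients c = (c₁,…,c_L) are a vector c : Vec ℕ L, with c_{s} = lookup c (s-1).
-- Tuples (a₁,…,a_n) are lists of naturals.
--
-- (a₁,…,a_n) is super-legal iff there are s ∈ {1,…,L} (encoded as i : Fin L, s = toℕ i + 1),
-- x < c_s, ℓ ≥ 0, and a tail `rest` which is empty or super-legal, such that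
--   (a₁,…,a_n) = (c₁,…,c_{s-1}) ++ (x) ++ (0,…,0 [ℓ times]) ++ rest.
data SuperLegal {L : ℕ} (c : Vec ℕ L) : List ℕ → Set where
  superLegal : (i : Fin L) (x : ℕ) → x < lookup c i → (ℓ : ℕ) (rest : List ℕ) →
               (rest ≡ [] ⊎ SuperLegal c rest) →
               SuperLegal c (take (toℕ i) (toList c) ++ x ∷ replicate ℓ 0 ++ rest)

record NumSuperLegal {L : ℕ} (c : Vec ℕ L) (n k : ℕ) : Set where
  field
    tuples   : List (List ℕ)
    unique   : Unique tuples
    complete : ∀ (a : List ℕ) → (a ∈ tuples) ⇔ (length a ≡ n × SuperLegal c a)
    size     : length tuples ≡ k

recSum : {L : ℕ} → Vec ℕ L → (ℕ → ℕ) → ℕ → ℕ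
recSum {L} c H n = sum (tabulate {n = L} (λ i → lookup c i * H (n ∸ toℕ i)))

-- Because c₁ ≥ 1, a single 0 is a block on its own (s = 1, x = 0), so the zero
-- padding in the definition of super-legality can be absorbed into the tail: a
-- tuple is super-legal or empty iff it is empty or of the form
-- c₁ … c_{s-1} x ++ r with x < c_s and r super-legal or empty. Enumerating the
-- tuples of length n + 1 by the choice of s, x and a tail of length n + 1 - s
-- counts them as Σ_s c_s · H_{n+1-s}, where an empty tail counts once; for
-- n ≥ L every tail is non-empty, which gives the recurrence.
module Submission where

open import Defs
open import Data.Nat using (ℕ; zero; suc; _≤_; _<_; _∸_; _+_; _*_; z≤n; s≤s)
open import Data.Nat.Properties using (suc-injective; 0≢1+n; m<n⇒0<n∸m; <-≤-trans; <-irrefl; n≤1+n; ≤-trans)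
open import Data.Fin using (Fin; toℕ) renaming (zero to fzero; suc to fsuc)
open import Data.Fin.Properties using (toℕ<n)
open import Data.Vec using (Vec; []; _∷_; lookup; toList; tabulate; sum)
open import Data.Vec.Properties using (tabulate-cong)
open import Data.List using (List; []; _∷_; _++_; take; replicate; length; map; upTo; cartesianProductWith)
open import Data.List.Properties using (length-++; length-map; length-upTo; ∷-injective; ∷-injectiveˡ; ∷-injectiveʳ; ++-conicalʳ)
open import Data.List.Membership.Propositional using (_∈_)
open import Data.List.Membership.Propositional.Properties
  using (∈-++⁻; ∈-++⁺ˡ; ∈-++⁺ʳ; ∈-map⁺; ∈-map⁻; ∈-upTo⁺; ∈-upTo⁻; ∈-cartesianProductWith⁺; ∈-cartesianProductWith⁻)
open import Data.List.Membership.Propositional.Properties.WithK using (unique∧set⇒bag)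
open import Data.List.Relation.Binary.BagAndSetEquality using (∼bag⇒↭)
open import Data.List.Relation.Binary.Permutation.Propositional.Properties using (↭-length)
open import Data.List.Relation.Binary.Disjoint.Propositional using (Disjoint)
open import Data.List.Relation.Unary.Any using (here)
open import Data.List.Relation.Unary.All using ([])
open import Data.List.Relation.Unary.AllPairs using ([]; _∷_)
open import Data.List.Relation.Unary.Unique.Propositional using (Unique)
open import Data.List.Relation.Unary.Unique.Propositional.Properties using (++⁺; map⁺; cartesianProductWith⁺; upTo⁺)
open import Data.Product using (Σ; ∃₂; _×_; _,_)
open import Data.Sum using (_⊎_; inj₁; inj₂)
open import Data.Empty using (⊥-elim)
open import Function using (_∘_)
open import Function.Bundles using (_⇔_; mk⇔; Equivalence)
import Function.Properties.Equivalence as ⇔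
open import Relation.Binary.PropositionalEquality using (_≡_; refl; sym; trans; cong; cong₂; module ≡-Reasoning)

open Equivalence using (to; from)

length-cartesianProductWith : {A B C : Set} (f : A → B → C) (xs : List A) (ys : List B) →
                              length (cartesianProductWith f xs ys) ≡ length xs * length ys
length-cartesianProductWith f []       ys = refl
length-cartesianProductWith f (x ∷ xs) ys = begin
  length (map (f x) ys ++ cartesianProductWith f xs ys)          ≡⟨ length-++ (map (f x) ys) ⟩
  length (map (f x) ys) + length (cartesianProductWith f xs ys)  ≡⟨ cong₂ _+_ (length-map (f x) ys)
                                                                      (length-cartesianProductWith f xs ys) ⟩
  length ys + length xs * length ys                              ∎
  where open ≡-Reasoning

unique∧set⇒length≡ : {A : Set} {xs ys : List A} → Unique xs → Unique ys →
                     (∀ {a} → a ∈ xs ⇔ a ∈ ys) → length xs ≡ length ys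
unique∧set⇒length≡ ux uy same = ↭-length (∼bag⇒↭ (unique∧set⇒bag ux uy same))

recSum-cong : ∀ {L} (c : Vec ℕ L) {f g : ℕ → ℕ} n →
              (∀ (i : Fin L) → f (n ∸ toℕ i) ≡ g (n ∸ toℕ i)) → recSum c f n ≡ recSum c g n
recSum-cong c n f≗g = cong sum (tabulate-cong (λ i → cong (lookup c i *_) (f≗g i)))

SuperLegalOrEmpty : ∀ {L} → Vec ℕ L → List ℕ → Set
SuperLegalOrEmpty c a = a ≡ [] ⊎ SuperLegal c a

BlockThen : ∀ {m} → Vec ℕ m → (List ℕ → Set) → List ℕ → Set
BlockThen {m} d P a = Σ (Fin m) λ i → ∃₂ λ x r →
  x < lookup d i × P r × a ≡ take (toℕ i) (toList d) ++ x ∷ r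

module _ {L} (c : Vec ℕ (suc L)) (c₁≥1 : 1 ≤ lookup c fzero) where

  zeros++-superLegalOrEmpty : ∀ ℓ {r} → SuperLegalOrEmpty c r → SuperLegalOrEmpty c (replicate ℓ 0 ++ r)
  zeros++-superLegalOrEmpty zero    r-legal = r-legal
  zeros++-superLegalOrEmpty (suc ℓ) r-legal =
    inj₂ (superLegal fzero 0 c₁≥1 0 _ (zeros++-superLegalOrEmpty ℓ r-legal))

  superLegalOrEmpty-unfold : ∀ {a} →
    SuperLegalOrEmpty c a ⇔ (a ≡ [] ⊎ BlockThen c (SuperLegalOrEmpty c) a)
  superLegalOrEmpty-unfold = mk⇔ unblock block
    where
    unblock : ∀ {a} → SuperLegalOrEmpty c a → a ≡ [] ⊎ BlockThen c (SuperLegalOrEmpty c) a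
    unblock (inj₁ a≡[]) = inj₁ a≡[]
    unblock (inj₂ (superLegal i x x<cᵢ ℓ rest rest-legal)) =
      inj₂ (i , x , replicate ℓ 0 ++ rest , x<cᵢ , zeros++-superLegalOrEmpty ℓ rest-legal , refl)
    block : ∀ {a} → a ≡ [] ⊎ BlockThen c (SuperLegalOrEmpty c) a → SuperLegalOrEmpty c a
    block (inj₁ a≡[]) = inj₁ a≡[]
    block (inj₂ (i , x , r , x<cᵢ , r-legal , refl)) = inj₂ (superLegal i x x<cᵢ 0 r r-legal)

length≡suc⇒superLegalOrEmpty⇔superLegal : ∀ {L} (c : Vec ℕ L) n {a} →
  (length a ≡ suc n × SuperLegalOrEmpty c a) ⇔ (length a ≡ suc n × SuperLegal c a)
length≡suc⇒superLegalOrEmpty⇔superLegal c n = mk⇔ drop-empty (λ (len , a-legal) → len , inj₂ a-legal)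
  where
  drop-empty : ∀ {a} → length a ≡ suc n × SuperLegalOrEmpty c a → length a ≡ suc n × SuperLegal c a
  drop-empty (()  , inj₁ refl)
  drop-empty (len , inj₂ a-legal) = len , a-legal

module Enumeration {L} (c : Vec ℕ L) where

  digits : ℕ → List (List ℕ) → List (List ℕ)
  digits x = cartesianProductWith _∷_ (upTo x)

  -- legal n lists the tuples of length n that are a concatenation of blocks
  -- c₁ … c_{s-1} x with x < c_s; starting d n lists those of length n whose first
  -- block is taken from the coefficient vector d (a suffix of c in the recursion).
  legal    : ℕ → List (List ℕ)
  starting : ∀ {m} → Vec ℕ m → ℕ → List (List ℕ)

  legal zero    = [] ∷ []
  legal (suc n) = starting c (suc n)

  starting []      n       = []
  starting (x ∷ d) zero    = []
  starting (x ∷ d) (suc n) = digits x (legal n) ++ map (x ∷_) (starting d n)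

  digits-disjoint : ∀ x h t → Disjoint (digits x h) (map (x ∷_) t)
  digits-disjoint x h t (p , q) with ∈-cartesianProductWith⁻ _∷_ (upTo x) h p | ∈-map⁻ (x ∷_) q
  ... | y , _ , y∈ , _ , refl | _ , _ , y∷r≡x∷s = <-irrefl (∷-injectiveˡ y∷r≡x∷s) (∈-upTo⁻ y∈)

  unique-legal    : ∀ n → Unique (legal n)
  unique-starting : ∀ {m} (d : Vec ℕ m) n → Unique (starting d n)

  unique-legal zero    = [] ∷ []
  unique-legal (suc n) = unique-starting c (suc n)

  unique-starting []      n       = []
  unique-starting (x ∷ d) zero    = []
  unique-starting (x ∷ d) (suc n) =
    ++⁺ (cartesianProductWith⁺ _∷_ ∷-injective (upTo⁺ x) (unique-legal n))
        (map⁺ ∷-injectiveʳ (unique-starting d n))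
        (digits-disjoint x (legal n) (starting d n))

  length-digits : ∀ x h → length (digits x h) ≡ x * length h
  length-digits x h = trans (length-cartesianProductWith _∷_ (upTo x) h) (cong (_* length h) (length-upTo x))

  length-starting : ∀ {m} (d : Vec ℕ m) n → m ≤ n →
    length (starting d n) ≡ sum (tabulate (λ i → lookup d i * length (legal (n ∸ suc (toℕ i)))))
  length-starting []      n       _           = refl
  length-starting (x ∷ d) (suc n) (s≤s m≤n) = begin
    length (digits x (legal n) ++ map (x ∷_) (starting d n))         ≡⟨ length-++ (digits x (legal n)) ⟩
    length (digits x (legal n)) + length (map (x ∷_) (starting d n)) ≡⟨ cong₂ _+_ (length-digits x (legal n))
                                                                          (trans (length-map (x ∷_) (starting d n))
                                                                                 (length-starting d n m≤n)) ⟩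
    x * length (legal n) + sum (tabulate (λ i → lookup d i * length (legal (n ∸ suc (toℕ i))))) ∎
    where open ≡-Reasoning

  length-legal : ∀ n → L ≤ suc n → length (legal (suc n)) ≡ recSum c (length ∘ legal) n
  length-legal n = length-starting c (suc n)

  module _ (P : List ℕ → Set) (P-unfold : ∀ {a} → P a ⇔ (a ≡ [] ⊎ BlockThen c P a)) where

    ∈-legal⁺    : ∀ n {a} → length a ≡ n × P a → a ∈ legal n
    ∈-legal⁻    : ∀ n {a} → a ∈ legal n → length a ≡ n × P a
    ∈-starting⁺ : ∀ {m} (d : Vec ℕ m) n {a} → length a ≡ n × BlockThen d P a → a ∈ starting d n
    ∈-starting⁻ : ∀ {m} (d : Vec ℕ m) n {a} → a ∈ starting d n → length a ≡ n × BlockThen d P a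

    ∈-legal⁺ zero    {[]}    _ = here refl
    ∈-legal⁺ (suc n) {a} (len , Pa) with to P-unfold Pa
    ... | inj₁ refl = ⊥-elim (0≢1+n len)
    ... | inj₂ a-blocks = ∈-starting⁺ c (suc n) (len , a-blocks)

    ∈-legal⁻ zero    (here refl) = refl , from P-unfold (inj₁ refl)
    ∈-legal⁻ (suc n) a∈ with ∈-starting⁻ c (suc n) a∈
    ... | len , a-blocks = len , from P-unfold (inj₂ a-blocks)

    ∈-starting⁺ (x ∷ d) zero {[]} (_ , i , y , r , _ , _ , []≡)
      with ++-conicalʳ (take (toℕ i) (toList (x ∷ d))) (y ∷ r) (sym []≡)
    ... | ()
    ∈-starting⁺ (x ∷ d) (suc n) (len , fzero , y , r , y<x , Pr , refl) =
      ∈-++⁺ˡ (∈-cartesianProductWith⁺ _∷_ (∈-upTo⁺ y<x) (∈-legal⁺ n (suc-injective len , Pr)))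
    ∈-starting⁺ (x ∷ d) (suc n) (len , fsuc i , y , r , y<dᵢ , Pr , refl) =
      ∈-++⁺ʳ (digits x (legal n))
        (∈-map⁺ (x ∷_) (∈-starting⁺ d n (suc-injective len , i , y , r , y<dᵢ , Pr , refl)))

    ∈-starting⁻ (x ∷ d) (suc n) a∈ with ∈-++⁻ (digits x (legal n)) a∈
    ... | inj₁ a∈digits with ∈-cartesianProductWith⁻ _∷_ (upTo x) (legal n) a∈digits
    ...   | y , r , y∈ , r∈ , refl with ∈-legal⁻ n r∈
    ...     | len , Pr = cong suc len , fzero , y , r , ∈-upTo⁻ y∈ , Pr , refl
    ∈-starting⁻ (x ∷ d) (suc n) a∈ | inj₂ a∈shifted with ∈-map⁻ (x ∷_) a∈shifted
    ... | b , b∈ , refl with ∈-starting⁻ d n b∈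
    ...   | len , i , y , r , y<dᵢ , Pr , b≡ = cong suc len , fsuc i , y , r , y<dᵢ , Pr , cong (x ∷_) b≡

    ∈-legal : ∀ n {a} → a ∈ legal n ⇔ (length a ≡ n × P a)
    ∈-legal n = mk⇔ (∈-legal⁻ n) (∈-legal⁺ n)

open Enumeration

NumSuperLegal-unique : ∀ {L} {c : Vec ℕ L} {n k k′} → NumSuperLegal c n k → NumSuperLegal c n k′ → k ≡ k′
NumSuperLegal-unique N N′ =
  trans (sym (size N)) (trans (unique∧set⇒length≡ (unique N) (unique N′) same-members) (size N′))
  where
  open NumSuperLegal
  same-members : ∀ {a} → a ∈ tuples N ⇔ a ∈ tuples N′
  same-members {a} = ⇔.trans (complete N a) (⇔.sym (complete N′ a))

numSuperLegal-legal : ∀ {L} (c : Vec ℕ (suc L)) → 1 ≤ lookup c fzero →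
                      ∀ n → 1 ≤ n → NumSuperLegal c n (length (legal c n))
numSuperLegal-legal c c₁≥1 (suc n) _ = record
  { tuples   = legal c (suc n)
  ; unique   = unique-legal c (suc n)
  ; complete = λ a → ⇔.trans (∈-legal c (SuperLegalOrEmpty c) (superLegalOrEmpty-unfold c c₁≥1) (suc n))
                             (length≡suc⇒superLegalOrEmpty⇔superLegal c n)
  ; size     = refl
  }

mainTheorem2 : (L : ℕ) → 1 ≤ L → (c : Vec ℕ L) →
                 (∀ (i : Fin L) → toℕ i ≡ 0 → 1 ≤ lookup c i) →
                 (∀ (i : Fin L) → toℕ i ≡ L ∸ 1 → 1 ≤ lookup c i) →
                 (∀ (n : ℕ) → 1 ≤ n → Σ ℕ (λ k → NumSuperLegal c n k)) ×
                 (∀ (H : ℕ → ℕ) → (∀ (n : ℕ) → 1 ≤ n → NumSuperLegal c n (H n)) →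
                   ∀ (n : ℕ) → L ≤ n → H (suc n) ≡ recSum c H n)
mainTheorem2 (suc L) _ c c₁≥1 _ = (λ n 1≤n → _ , numSuperLegal n 1≤n) , recurrence
  where
  numSuperLegal : ∀ n → 1 ≤ n → NumSuperLegal c n (length (legal c n))
  numSuperLegal = numSuperLegal-legal c (c₁≥1 fzero refl)

  recurrence : ∀ H → (∀ n → 1 ≤ n → NumSuperLegal c n (H n)) → ∀ n → suc L ≤ n → H (suc n) ≡ recSum c H n
  recurrence H count n L<n = begin
    H (suc n)                          ≡⟨ H≡ (suc n) (s≤s z≤n) ⟩
    length (legal c (suc n))           ≡⟨ length-legal c n (≤-trans L<n (n≤1+n n)) ⟩
    recSum c (length ∘ legal c) n      ≡⟨ recSum-cong c {length ∘ legal c} {H} n (λ i → sym (H≡ (n ∸ toℕ i) (m<n⇒0<n∸m (<-≤-trans (toℕ<n i) L<n)))) ⟩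
    recSum c H n                       ∎
    where
    open ≡-Reasoning
    H≡ : ∀ k → 1 ≤ k → H k ≡ length (legal c k)
    H≡ k 1≤k = NumSuperLegal-unique (count k 1≤k) (numSuperLegal k 1≤k)
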